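{- For all positive integers $n,p$, $$\beta^*(n,p,\infty)=\Omega\left(n^{2/3}p^{2/3}+n+p\right).$$
   Context: A path system is a pair $(V,\Pi)$ with $V$ a finite node set and $\Pi$ a finite multiset of paths, each a finite sequence of pairwise distinct nodes; the size is $\sum_{\pi\in\Pi}|\pi|$ where $|\pi|$ is the number of nodes. A $b$-bridge consists of $b$ distinct nodes $v_1,\dots,v_b$ and $b$ distinct paths $\pi_1,\dots,\pi_b$ with $v_i$ preceding $v_{i+1}$ on $\pi_i$ for $1\le i\le b-1$ and $v_1$ preceding $v_b$ on $\pi_b$ ($\pi_b$ the river, others arcs). An ordered path system has a total order on its paths; an ordered bridge is a bridge whose river comes after all its arcs in this order. $\beta^*(n,p,\infty)$ is the maximum size of an ordered path system with $n$ nodes, $p$ paths and no ordered bridge. -}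

module Defs where

open import Data.Nat using (ℕ; zero; suc; _+_; _*_; _<_; _≤_; _^_)
open import Data.Fin using (Fin; toℕ; inject₁; fromℕ) renaming (zero to fzero; suc to fsuc) renaming (_<_ to _<ᶠ_)
open import Data.List using (List; length; lookup; map)
open import Data.Nat.ListAction using (sum)
open import Data.List.Relation.Unary.Unique.Propositional using (Unique)
open import Data.Vec using (Vec; toList) renaming (lookup to vlookup)
open import Data.Product using (Σ; ∃-syntax; _×_)
open import Function.Definitions using (Injective)
open import Relation.Binary.PropositionalEquality using (_≡_)
open import Relation.Nullary using (¬_)

Path : ℕ → Set
Path n = Σ (List (Fin n)) Unique

-- An ordered path system with n nodes and p paths.  The multiset of
-- paths is a vector indexed by Fin p (repetitions allowed); the total
-- order on the paths is the order of their indices.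
OrderedPathSystem : ℕ → ℕ → Set
OrderedPathSystem n p = Vec (Path n) p

pathNodes : ∀ {n} → Path n → List (Fin n)
pathNodes (l Data.Product., _) = l

size : ∀ {n p} → OrderedPathSystem n p → ℕ
size S = sum (map (λ π → length (pathNodes π)) (toList S))

Precedes : ∀ {n} → Fin n → Fin n → Path n → Set
Precedes u w π =
  ∃[ i ] ∃[ j ] (i <ᶠ j × lookup (pathNodes π) i ≡ u × lookup (pathNodes π) j ≡ w)

-- An ordered (suc m)-bridge in S: distinct nodes v 0 … v m, distinct paths
-- π 0 … π m (given by indices into S); the arcs are π (inject₁ i) for i < m,
-- the river is π (fromℕ m).  v i precedes v (i+1) on arc i, v 0 precedes
-- v m on the river, and the river comes after every arc in the order.
OrderedBridge : ∀ {n p} → OrderedPathSystem n p → Set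
OrderedBridge {n} {p} S =
  Σ ℕ λ m → Σ (Fin (suc m) → Fin n) λ v → Σ (Fin (suc m) → Fin p) λ π →
    ( Injective _≡_ _≡_ v
    × Injective _≡_ _≡_ π
    × (∀ (i : Fin m) → Precedes (v (inject₁ i)) (v (fsuc i)) (vlookup S (π (inject₁ i))))
    × Precedes (v fzero) (v (fromℕ m)) (vlookup S (π (fromℕ m)))
    × (∀ (i : Fin m) → toℕ (π (inject₁ i)) < toℕ (π (fromℕ m))) )

NoOrderedBridge : ∀ {n p} → OrderedPathSystem n p → Set
NoOrderedBridge S = ¬ OrderedBridge S

{-# OPTIONS --safe #-}
module Submission where

-- Put the nodes on a grid of width k and take as paths the lines y = a x + b
-- with slope a < s and intercept b < t, traversed left to right and ordered by
-- slope.  For the slope a of a river, the potential Y − a X never increases along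
-- an earlier line (whose slope is at most a), and strictly decreases along the
-- first arc, which cannot share the river's slope without being the river's line;
-- yet it takes the same value at both ends of the river, so no ordered bridge
-- exists.  Taking k ≈ (n²/p)^(1/3), s ≈ (p/k)^(1/2) and t = s k gives about
-- n nodes, p lines and size s² k² ≈ (n p)^(2/3); when p ≳ n² or n ≳ p² a single
-- line through all nodes, padded with one-node paths, is already large enough.

open import Defs
open import Data.Nat using (ℕ; zero; suc; pred; _+_; _*_; _^_; _⊔_; _<_; _≤_; _≤?_; _<?_; z≤n; s≤s; z<s; s<s; NonZero; >-nonZero; >-nonZero⁻¹; _/_; _%_)
open import Data.Nat.Properties
open import Data.Nat.DivMod
open import Data.Nat.Tactic.RingSolver
open import Data.Fin as Fin using (Fin; toℕ; fromℕ<; inject₁; fromℕ; cast) renaming (zero to fzero; suc to fsuc)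
open import Data.Fin.Properties using (toℕ-fromℕ<; toℕ<n; toℕ-injective; toℕ-cast; cast-involutive)
open import Data.List using ([]; _∷_; [_]; length; lookup; tabulate)
open import Data.List.Properties using (length-tabulate; lookup-tabulate)
open import Data.List.Relation.Unary.Unique.Propositional using (Unique; []; _∷_)
open import Data.List.Relation.Unary.Unique.Propositional.Properties using (tabulate⁺)
import Data.List.Relation.Unary.All as All
import Data.Vec as Vec
open import Data.Vec.Properties using (lookup∘tabulate)
open import Data.Product using (Σ; ∃-syntax; _×_; _,_; proj₁; proj₂)
open import Data.Sum using (inj₁; inj₂)
open import Function using (_∘_)
open import Relation.Nullary using (¬_; Dec; yes; no; contradiction)
open import Relation.Unary using (Decidable)
open import Relation.Binary.PropositionalEquality using (_≡_; refl; sym; trans; cong; cong₂; subst; subst₂; module ≡-Reasoning)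

m*m≤n*n⇒m≤n : ∀ {m n} → m * m ≤ n * n → m ≤ n
m*m≤n*n⇒m≤n {m} {n} m²≤n² with m ≤? n
... | yes m≤n = m≤n
... | no  m≰n = contradiction m²≤n² (<⇒≱ (*-mono-< (≰⇒> m≰n) (≰⇒> m≰n)))

m*m<n*n⇒m<n : ∀ {m n} → m * m < n * n → m < n
m*m<n*n⇒m<n {m} {n} m²<n² with m <? n
... | yes m<n = m<n
... | no  m≮n = contradiction m²<n² (≤⇒≯ (*-mono-≤ (≮⇒≥ m≮n) (≮⇒≥ m≮n)))

1≤m⇒1+m≤m+m : ∀ {m} → 1 ≤ m → suc m ≤ m + m
1≤m⇒1+m≤m+m {m} = +-monoˡ-≤ m

cube-mono-≤ : ∀ {m n} → m ≤ n → m * m * m ≤ n * n * n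
cube-mono-≤ m≤n = *-mono-≤ (*-mono-≤ m≤n m≤n) m≤n

-- p + q′ ≤ q + p′ reads "p − p′ ≤ q − q′".
diff-≤-trans : ∀ {p p′ q q′ r r′} → p + q′ ≤ q + p′ → q + r′ ≤ r + q′ → p + r′ ≤ r + p′
diff-≤-trans {p} {p′} {q} {q′} {r} {r′} pq qr = +-cancelʳ-≤ (q + q′) _ _ (begin
  (p + r′) + (q + q′)  ≡⟨ solve (p ∷ r′ ∷ q ∷ q′ ∷ []) ⟩
  (p + q′) + (q + r′)  ≤⟨ +-mono-≤ pq qr ⟩
  (q + p′) + (r + q′)  ≡⟨ solve (q ∷ p′ ∷ r ∷ q′ ∷ []) ⟩
  (r + p′) + (q + q′)  ∎)
  where open ≤-Reasoning

diff-≤-<-trans : ∀ {p p′ q q′ r r′} → p + q′ ≤ q + p′ → q + r′ < r + q′ → p + r′ < r + p′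
diff-≤-<-trans {p} {p′} {q} {q′} {r} {r′} pq qr = +-cancelʳ-< (q + q′) _ _ (begin-strict
  (p + r′) + (q + q′)  ≡⟨ solve (p ∷ r′ ∷ q ∷ q′ ∷ []) ⟩
  (p + q′) + (q + r′)  <⟨ +-mono-≤-< pq qr ⟩
  (q + p′) + (r + q′)  ≡⟨ solve (q ∷ p′ ∷ r ∷ q′ ∷ []) ⟩
  (r + p′) + (q + q′)  ∎)
  where open ≤-Reasoning

-- (a − c)(y − x) ≥ 0, with the intercept b carried along.
rearrangement-≤ : ∀ {a b c x y} → c ≤ a → x ≤ y → (c * y + b) + a * x ≤ (c * x + b) + a * y
rearrangement-≤ {b = b} {c} {x} c≤a x≤y with m≤n⇒∃[o]m+o≡n c≤a | m≤n⇒∃[o]m+o≡n x≤y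
... | e , refl | d , refl = begin
  (c * (x + d) + b) + (c + e) * x          ≤⟨ m≤m+n _ (e * d) ⟩
  (c * (x + d) + b) + (c + e) * x + e * d  ≡⟨ solve (b ∷ c ∷ e ∷ x ∷ d ∷ []) ⟩
  (c * x + b) + (c + e) * (x + d)          ∎
  where open ≤-Reasoning

rearrangement-< : ∀ {a b c x y} → c < a → x < y → (c * y + b) + a * x < (c * x + b) + a * y
rearrangement-< {b = b} {c} {x} c<a x<y with m≤n⇒∃[o]m+o≡n c<a | m≤n⇒∃[o]m+o≡n x<y
... | e , refl | d , refl = begin-strict
  (c * suc (x + d) + b) + suc (c + e) * x                        <⟨ m<m+n _ z<s ⟩
  (c * suc (x + d) + b) + suc (c + e) * x + suc e * suc d        ≡⟨ solve (b ∷ c ∷ e ∷ x ∷ d ∷ []) ⟩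
  (c * x + b) + suc (c + e) * suc (x + d)                        ∎
  where open ≤-Reasoning

rearrangement-≡ : ∀ a b x y → (a * y + b) + a * x ≡ (a * x + b) + a * y
rearrangement-≡ a b x y = solve (a ∷ b ∷ x ∷ y ∷ [])

OnLine : ∀ {n} (X Y : Fin n → ℕ) (c b : ℕ) → Fin n → Set
OnLine X Y c b v = Y v ≡ c * X v + b

module Potential {n} (X Y : Fin n → ℕ) (a : ℕ) where

  -- u ⊒ w : the potential Y − a X does not increase from u to w (stated without subtraction).
  _⊒_ _⊐_ : Fin n → Fin n → Set
  u ⊒ w = Y w + a * X u ≤ Y u + a * X w
  u ⊐ w = Y w + a * X u < Y u + a * X w

  ⊒-trans : ∀ {u v w} → u ⊒ v → v ⊒ w → u ⊒ w
  ⊒-trans {u} {v} {w} u⊒v v⊒w =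
    diff-≤-trans {Y w} {a * X w} {Y v} {a * X v} {Y u} {a * X u} v⊒w u⊒v

  ⊐-⊒-trans : ∀ {u v w} → u ⊐ v → v ⊒ w → u ⊐ w
  ⊐-⊒-trans {u} {v} {w} u⊐v v⊒w =
    diff-≤-<-trans {Y w} {a * X w} {Y v} {a * X v} {Y u} {a * X u} v⊒w u⊐v

  ⊒-chain : ∀ m (v : Fin (suc m) → Fin n) → (∀ i → v (inject₁ i) ⊒ v (fsuc i)) → v fzero ⊒ v (fromℕ m)
  ⊒-chain zero    v step = ≤-refl
  ⊒-chain (suc m) v step = ⊒-trans (step fzero) (⊒-chain m (v ∘ fsuc) (step ∘ fsuc))

  ⊒-along : ∀ {b c u w} → c ≤ a → X u ≤ X w → OnLine X Y c b u → OnLine X Y c b w → u ⊒ w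
  ⊒-along c≤a Xu≤Xw u-on w-on rewrite u-on | w-on = rearrangement-≤ c≤a Xu≤Xw

  ⊐-along : ∀ {b c u w} → c < a → X u < X w → OnLine X Y c b u → OnLine X Y c b w → u ⊐ w
  ⊐-along c<a Xu<Xw u-on w-on rewrite u-on | w-on = rearrangement-< c<a Xu<Xw

  ¬⊐-on-line : ∀ {b u w} → OnLine X Y a b u → OnLine X Y a b w → ¬ u ⊐ w
  ¬⊐-on-line {b} {u} {w} u-on w-on rewrite u-on | w-on = <-irrefl (rearrangement-≡ a b (X u) (X w))

record LineDrawing {n p} (S : OrderedPathSystem n p) : Set where
  field
    X Y            : Fin n → ℕ
    slope icept    : Fin p → ℕ
    along          : ∀ j {u w} → Precedes u w (Vec.lookup S j) →
                     X u < X w × OnLine X Y (slope j) (icept j) u × OnLine X Y (slope j) (icept j) w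
    slope-mono     : ∀ {j r} → toℕ j < toℕ r → slope j ≤ slope r
    line-injective : ∀ {j r} → slope j ≡ slope r → icept j ≡ icept r → j ≡ r

module _ {n p} {S : OrderedPathSystem n p} (D : LineDrawing S) where
  open LineDrawing D

  module _ {r : Fin p} where
    open Potential X Y (slope r)

    arc-⊒ : ∀ {j u w} → toℕ j < toℕ r → Precedes u w (Vec.lookup S j) → u ⊒ w
    arc-⊒ {j} j<r u≺w with along j u≺w
    ... | Xu<Xw , u-on , w-on = ⊒-along (slope-mono j<r) (<⇒≤ Xu<Xw) u-on w-on

    -- An arc through a point of the river with the river's slope would lie on the river's line.
    arc-⊐ : ∀ {j u w} → toℕ j < toℕ r → Precedes u w (Vec.lookup S j) →
            OnLine X Y (slope r) (icept r) u → u ⊐ w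
    arc-⊐ {j} {u} j<r u≺w u-on-r with along j u≺w | m≤n⇒m<n∨m≡n (slope-mono j<r)
    ... | Xu<Xw , u-on , w-on | inj₁ slope< = ⊐-along slope< Xu<Xw u-on w-on
    ... | _     , u-on , _    | inj₂ slope≡ =
      contradiction (cong toℕ (line-injective slope≡ icept≡)) (<⇒≢ j<r)
      where
      icept≡ : icept j ≡ icept r
      icept≡ = +-cancelˡ-≡ (slope r * X u) _ _ (begin
        slope r * X u + icept j  ≡⟨ cong (λ c → c * X u + icept j) slope≡ ⟨
        slope j * X u + icept j  ≡⟨ u-on ⟨
        Y u                      ≡⟨ u-on-r ⟩
        slope r * X u + icept r  ∎)
        where open ≡-Reasoning

  noOrderedBridge : NoOrderedBridge S
  noOrderedBridge (zero , v , π , _ , _ , _ , river , _) = <-irrefl refl (proj₁ (along _ river))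
  noOrderedBridge (suc m , v , π , _ , _ , arcs , river , before) with along (π (fromℕ (suc m))) river
  ... | _ , v₀-on , vₘ-on = ¬⊐-on-line v₀-on vₘ-on (⊐-⊒-trans first rest)
    where
    open Potential X Y (slope (π (fromℕ (suc m))))
    first : v fzero ⊐ v (fsuc fzero)
    first = arc-⊐ (before fzero) (arcs fzero) v₀-on
    rest : v (fsuc fzero) ⊒ v (fromℕ (suc m))
    rest = ⊒-chain m (v ∘ fsuc) (λ i → arc-⊒ (before (fsuc i)) (arcs (fsuc i)))

Precedes-tabulate : ∀ {n k} {f : Fin k → Fin n} {f-unique : Unique (tabulate f)} {u w} →
                    Precedes u w (tabulate f , f-unique) → ∃[ i ] ∃[ j ] (i Fin.< j × f i ≡ u × f j ≡ w)
Precedes-tabulate {f = f} (i , j , i<j , fi≡u , fj≡w) =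
  index i , index j , subst₂ _<_ (sym (toℕ-cast _ i)) (sym (toℕ-cast _ j)) i<j ,
  trans (lookup-index i) fi≡u , trans (lookup-index j) fj≡w
  where
  index : Fin (length (tabulate f)) → Fin _
  index = cast (length-tabulate f)
  lookup-index : ∀ i → f (index i) ≡ lookup (tabulate f) i
  lookup-index i = trans (sym (lookup-tabulate f (index i)))
    (cong (lookup (tabulate f)) (cast-involutive (sym (length-tabulate f)) (length-tabulate f) i))

size-tabulate-≥ : ∀ {n p} q c (f : Fin p → Path n) → q ≤ p →
                  (∀ j → toℕ j < q → c ≤ length (pathNodes (f j))) → q * c ≤ size (Vec.tabulate f)
size-tabulate-≥ zero    c f _         _    = z≤n
size-tabulate-≥ (suc q) c f (s≤s q≤p) long =
  +-mono-≤ (long fzero z<s) (size-tabulate-≥ q c (f ∘ fsuc) q≤p (λ j j<q → long (fsuc j) (s<s j<q)))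

divMod-injective : ∀ {m n d} .⦃ _ : NonZero d ⦄ → m / d ≡ n / d → m % d ≡ n % d → m ≡ n
divMod-injective {m} {n} {d} quot≡ rem≡ = begin
  m                  ≡⟨ m≡m%n+[m/n]*n m d ⟩
  m % d + m / d * d  ≡⟨ cong₂ (λ r q → r + q * d) rem≡ quot≡ ⟩
  n % d + n / d * d  ≡⟨ m≡m%n+[m/n]*n n d ⟨
  n                  ∎
  where open ≡-Reasoning

module GridSystem (n p s k t : ℕ) ⦃ _ : NonZero k ⦄ ⦃ _ : NonZero t ⦄
                  (grid≤n : k * (pred s * pred k + t) ≤ n) (lines≤p : s * t ≤ p) where

  height : ℕ
  height = pred s * pred k + t

  -- The grid point (x, y) is the node x + y k.
  point<n : ∀ {x y} → x < k → y < height → x + y * k < n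
  point<n {x} {y} x<k y<h = begin-strict
    x + y * k    <⟨ +-monoˡ-< (y * k) x<k ⟩
    suc y * k    ≤⟨ *-monoˡ-≤ k y<h ⟩
    height * k   ≡⟨ *-comm height k ⟩
    k * height   ≤⟨ grid≤n ⟩
    n            ∎
    where open ≤-Reasoning

  point : ∀ x y → x < k → y < height → Fin n
  point x y x<k y<h = fromℕ< (point<n x<k y<h)

  X Y : Fin n → ℕ
  X v = toℕ v % k
  Y v = toℕ v / k

  module _ {x y} (x<k : x < k) (y<h : y < height) where

    X-point : X (point x y x<k y<h) ≡ x
    X-point = begin
      toℕ (point x y x<k y<h) % k  ≡⟨ cong (_% k) (toℕ-fromℕ< _) ⟩
      (x + y * k) % k              ≡⟨ [m+kn]%n≡m%n x y k ⟩
      x % k                        ≡⟨ m<n⇒m%n≡m x<k ⟩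
      x                            ∎
      where open ≡-Reasoning

    Y-point : Y (point x y x<k y<h) ≡ y
    Y-point = begin
      toℕ (point x y x<k y<h) / k  ≡⟨ cong (_/ k) (toℕ-fromℕ< _) ⟩
      (x + y * k) / k              ≡⟨ +-distrib-/ x (y * k) no-carry ⟩
      x / k + y * k / k            ≡⟨ cong₂ _+_ (m<n⇒m/n≡0 x<k) (m*n/n≡m y k) ⟩
      y                            ∎
      where
      open ≡-Reasoning
      no-carry : x % k + y * k % k < k
      no-carry = subst (_< k) (sym (trans (cong₂ _+_ (m<n⇒m%n≡m x<k) (m*n%n≡0 y k)) (+-identityʳ x))) x<k

  below-height : ∀ {a b x} → a < s → b < t → x < k → a * x + b < height
  below-height a<s b<t x<k = +-mono-≤-< (*-mono-≤ (<⇒≤pred a<s) (<⇒≤pred x<k)) b<t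

  module _ {a b} (a<s : a < s) (b<t : b < t) where

    linePoint : Fin k → Fin n
    linePoint x = point (toℕ x) (a * toℕ x + b) (toℕ<n x) (below-height a<s b<t (toℕ<n x))

    X-linePoint : ∀ x → X (linePoint x) ≡ toℕ x
    X-linePoint x = X-point (toℕ<n x) (below-height a<s b<t (toℕ<n x))

    linePoint-on-line : ∀ x → OnLine X Y a b (linePoint x)
    linePoint-on-line x = trans (Y-point (toℕ<n x) (below-height a<s b<t (toℕ<n x))) (cong (λ x′ → a * x′ + b) (sym (X-linePoint x)))

    line : Path n
    line = tabulate linePoint , tabulate⁺ λ {x} {x′} eq →
      toℕ-injective (trans (sym (X-linePoint x)) (trans (cong X eq) (X-linePoint x′)))

    line-along : ∀ {u w} → Precedes u w line → X u < X w × OnLine X Y a b u × OnLine X Y a b w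
    line-along u≺w with Precedes-tabulate {f = linePoint} {f-unique = proj₂ line} u≺w
    ... | x , x′ , x<x′ , refl , refl =
      subst₂ _<_ (sym (X-linePoint x)) (sym (X-linePoint x′)) x<x′ , linePoint-on-line x , linePoint-on-line x′

  origin : Fin n
  origin = point 0 0 (>-nonZero⁻¹ k) (≤-trans (>-nonZero⁻¹ t) (m≤n+m t _))

  -- Padding with single-node paths makes the size at least p.
  pathAt : ∀ i → Dec (i < s * t) → Path n
  pathAt i (yes i<st) = line (m<n*o⇒m/o<n i<st) (m%n<n i t)
  pathAt i (no  _)    = [ origin ] , All.[] ∷ []

  system : OrderedPathSystem n p
  system = Vec.tabulate λ j → pathAt (toℕ j) (toℕ j <? s * t)

  pathAt-along : ∀ i d {u w} → Precedes u w (pathAt i d) →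
                 X u < X w × OnLine X Y (i / t) (i % t) u × OnLine X Y (i / t) (i % t) w
  pathAt-along i (yes i<st) u≺w = line-along (m<n*o⇒m/o<n i<st) (m%n<n i t) u≺w
  pathAt-along i (no _) (fzero , fzero , () , _)

  drawing : LineDrawing system
  drawing = record
    { X = X
    ; Y = Y
    ; slope = λ j → toℕ j / t
    ; icept = λ j → toℕ j % t
    ; along = λ j u≺w → pathAt-along (toℕ j) (toℕ j <? s * t) (subst (Precedes _ _) (lookup∘tabulate _ j) u≺w)
    ; slope-mono = λ j<r → /-monoˡ-≤ t (<⇒≤ j<r)
    ; line-injective = λ slope≡ icept≡ → toℕ-injective (divMod-injective slope≡ icept≡)
    }

  size-≥-lines : s * t * k ≤ size system
  size-≥-lines = size-tabulate-≥ (s * t) k _ lines≤p λ j → long (toℕ j) (toℕ j <? s * t)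
    where
    long : ∀ i d → i < s * t → k ≤ length (pathNodes (pathAt i d))
    long i (yes _)   _    = ≤-reflexive (sym (length-tabulate _))
    long i (no i≮st) i<st = contradiction i<st i≮st

  size-≥-paths : p ≤ size system
  size-≥-paths = subst (_≤ size system) (*-identityʳ p)
                       (size-tabulate-≥ p 1 _ ≤-refl λ j _ → nonempty (toℕ j) (toℕ j <? s * t))
    where
    nonempty : ∀ i d → 1 ≤ length (pathNodes (pathAt i d))
    nonempty i (yes _) = subst (1 ≤_) (sym (length-tabulate _)) (>-nonZero⁻¹ k)
    nonempty i (no _)  = ≤-refl

lastBeforeFailure : ∀ {P : ℕ → Set} → Decidable P → ∀ {m} d → P m → ¬ P (m + d) →
                    ∃[ k ] m ≤ k × P k × ¬ P (suc k)
lastBeforeFailure {P} P? {m} zero    Pm ¬P = contradiction Pm (subst (λ i → ¬ P i) (+-identityʳ m) ¬P)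
lastBeforeFailure {P} P? {m} (suc d) Pm ¬P with P? (suc m)
... | no  ¬Psm = m , ≤-refl , Pm , ¬Psm
... | yes Psm with lastBeforeFailure P? d Psm (subst (λ i → ¬ P i) (+-suc m d) ¬P)
...   | k , m<k , Pk , ¬Psk = k , <⇒≤ m<k , Pk , ¬Psk

[64z]³≡262144z³ : ∀ z → (64 * z) ^ 3 ≡ 262144 * (z * z * z)
[64z]³≡262144z³ = expand
  where
  expand : ∀ z → 64 * z * (64 * z * (64 * z * 1)) ≡ 262144 * (z * z * z)
  expand = solve-∀

Ample : ℕ → ℕ → ℕ → Set
Ample n p z = n * n * p * p ≤ (64 * z) ^ 3 × n ≤ 64 * z × p ≤ 64 * z

Ample-mono : ∀ {n p z z′} → z ≤ z′ → Ample n p z → Ample n p z′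
Ample-mono z≤z′ (np≤ , n≤ , p≤) = ≤-trans np≤ (^-monoˡ-≤ 3 64z≤) , ≤-trans n≤ 64z≤ , ≤-trans p≤ 64z≤
  where 64z≤ = *-monoʳ-≤ 64 z≤z′

ample-⊔ : ∀ {n p} → n * n * p * p ≤ 8 * ((n ⊔ p) * (n ⊔ p) * (n ⊔ p)) → Ample n p (n ⊔ p)
ample-⊔ {n} {p} np≤ = ≤-trans np≤ 8z³≤ , ≤-trans (m≤m⊔n n p) (m≤n*m _ 64) , ≤-trans (m≤n⊔m n p) (m≤n*m _ 64)
  where
  z = n ⊔ p
  8z³≤ : 8 * (z * z * z) ≤ (64 * z) ^ 3
  8z³≤ = begin
    8 * (z * z * z)                  ≤⟨ *-monoˡ-≤ (z * z * z) (m≤m+n 8 262136) ⟩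
    262144 * (z * z * z)             ≡⟨ [64z]³≡262144z³ z ⟨
    (64 * z) ^ 3                     ∎
    where open ≤-Reasoning

few-nodes-bound : ∀ {n p} → n * n ≤ 8 * p → n * n * p * p ≤ 8 * ((n ⊔ p) * (n ⊔ p) * (n ⊔ p))
few-nodes-bound {n} {p} n²≤8p = begin
  n * n * p * p        ≤⟨ *-monoˡ-≤ p (*-monoˡ-≤ p n²≤8p) ⟩
  8 * p * p * p        ≡⟨ solve (p ∷ []) ⟩
  8 * (p * p * p)      ≤⟨ *-monoʳ-≤ 8 (cube-mono-≤ (m≤n⊔m n p)) ⟩
  8 * ((n ⊔ p) * (n ⊔ p) * (n ⊔ p)) ∎
  where open ≤-Reasoning

few-paths-bound : ∀ {n p} → p * p ≤ n → n * n * p * p ≤ 8 * ((n ⊔ p) * (n ⊔ p) * (n ⊔ p))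
few-paths-bound {n} {p} p²≤n = begin
  n * n * p * p        ≡⟨ solve (n ∷ p ∷ []) ⟩
  n * n * (p * p)      ≤⟨ *-monoʳ-≤ (n * n) p²≤n ⟩
  n * n * n            ≤⟨ cube-mono-≤ (m≤m⊔n n p) ⟩
  (n ⊔ p) * (n ⊔ p) * (n ⊔ p)  ≤⟨ m≤n*m _ 8 ⟩
  8 * ((n ⊔ p) * (n ⊔ p) * (n ⊔ p)) ∎
  where open ≤-Reasoning

8k³p≤n²⇒p*p≤n : ∀ {n p k} → p ≤ k → 8 * (k * k * k) * p ≤ n * n → p * p ≤ n
8k³p≤n²⇒p*p≤n {n} {p} {k} p≤k k-fits = m*m≤n*n⇒m≤n (begin
  p * p * (p * p)        ≡⟨ solve (p ∷ []) ⟩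
  p * p * p * p          ≤⟨ *-monoˡ-≤ p (cube-mono-≤ p≤k) ⟩
  k * k * k * p          ≤⟨ *-monoˡ-≤ p (m≤n*m (k * k * k) 8) ⟩
  8 * (k * k * k) * p    ≤⟨ k-fits ⟩
  n * n                  ∎)
  where open ≤-Reasoning

grid-fits : ∀ {n p s k} → 8 * (k * k * k) * p ≤ n * n → s * s * k ≤ p → k * (pred s * pred k + s * k) ≤ n
grid-fits {n} {p} {s} {k} k-fits s-fits = ≤-trans (*-monoʳ-≤ k (+-monoˡ-≤ (s * k) (*-mono-≤ (pred[n]≤n {s}) (pred[n]≤n {k}))))
  (m*m≤n*n⇒m≤n (begin
    k * (s * k + s * k) * (k * (s * k + s * k))  ≡⟨ solve (s ∷ k ∷ []) ⟩
    4 * (k * k * k) * (s * s * k)                ≤⟨ *-monoˡ-≤ (s * s * k) (*-monoˡ-≤ (k * k * k) (m≤m+n 4 4)) ⟩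
    8 * (k * k * k) * (s * s * k)                ≤⟨ *-monoʳ-≤ (8 * (k * k * k)) s-fits ⟩
    8 * (k * k * k) * p                          ≤⟨ k-fits ⟩
    n * n                                        ∎))
  where open ≤-Reasoning

paths-below : ∀ {p s k} → 1 ≤ s → p < suc s * suc s * k → p ≤ 4 * (s * s * k)
paths-below {p} {s} {k} 1≤s s+1-too-big = begin
  p                      ≤⟨ <⇒≤ s+1-too-big ⟩
  suc s * suc s * k      ≤⟨ *-monoˡ-≤ k (*-mono-≤ (1≤m⇒1+m≤m+m 1≤s) (1≤m⇒1+m≤m+m 1≤s)) ⟩
  (s + s) * (s + s) * k  ≡⟨ solve (s ∷ k ∷ []) ⟩
  4 * (s * s * k)        ∎
  where open ≤-Reasoning

nodes-below : ∀ {n p s k} → 1 ≤ k → n * n < 8 * (suc k * suc k * suc k) * p → p ≤ 4 * (s * s * k) →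
              n ≤ 16 * (s * k * k)
nodes-below {n} {p} {s} {k} 1≤k k+1-too-big p≤ = <⇒≤ (m*m<n*n⇒m<n (begin-strict
  n * n                                        <⟨ k+1-too-big ⟩
  8 * (suc k * suc k * suc k) * p              ≤⟨ *-monoˡ-≤ p (*-monoʳ-≤ 8 (cube-mono-≤ (1≤m⇒1+m≤m+m 1≤k))) ⟩
  8 * ((k + k) * (k + k) * (k + k)) * p        ≤⟨ *-monoʳ-≤ (8 * ((k + k) * (k + k) * (k + k))) p≤ ⟩
  8 * ((k + k) * (k + k) * (k + k)) * (4 * (s * s * k))  ≡⟨ solve (s ∷ k ∷ []) ⟩
  16 * (s * k * k) * (16 * (s * k * k))        ∎))
  where open ≤-Reasoning

ample-grid : ∀ {n p s k} → 1 ≤ s → 1 ≤ k → n ≤ 16 * (s * k * k) → p ≤ 4 * (s * s * k) →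
             Ample n p (s * (s * k) * k)
ample-grid {n} {p} {s} {k} 1≤s 1≤k n≤ p≤ = np≤ , n≤64z , p≤64z
  where
  open ≤-Reasoning
  z = s * (s * k) * k
  np≤ : n * n * p * p ≤ (64 * z) ^ 3
  np≤ = begin
    n * n * p * p                      ≤⟨ *-mono-≤ (*-mono-≤ (*-mono-≤ n≤ n≤) p≤) p≤ ⟩
    16 * (s * k * k) * (16 * (s * k * k)) * (4 * (s * s * k)) * (4 * (s * s * k))  ≡⟨ expand s k ⟩
    4096 * (z * z * z)                 ≤⟨ *-monoˡ-≤ (z * z * z) (m≤m+n 4096 258048) ⟩
    262144 * (z * z * z)               ≡⟨ [64z]³≡262144z³ z ⟨
    (64 * z) ^ 3                       ∎
    where
    expand : ∀ s k → 16 * (s * k * k) * (16 * (s * k * k)) * (4 * (s * s * k)) * (4 * (s * s * k))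
                   ≡ 4096 * (s * (s * k) * k * (s * (s * k) * k) * (s * (s * k) * k))
    expand = solve-∀
  n≤64z : n ≤ 64 * z
  n≤64z = begin
    n                          ≤⟨ n≤ ⟩
    16 * (s * k * k)           ≤⟨ m≤m*n _ (4 * s) ⦃ >-nonZero (≤-trans 1≤s (m≤n*m s 4)) ⦄ ⟩
    16 * (s * k * k) * (4 * s) ≡⟨ expand s k ⟩
    64 * z                     ∎
    where
    expand : ∀ s k → 16 * (s * k * k) * (4 * s) ≡ 64 * (s * (s * k) * k)
    expand = solve-∀
  p≤64z : p ≤ 64 * z
  p≤64z = begin
    p                           ≤⟨ p≤ ⟩
    4 * (s * s * k)             ≤⟨ m≤m*n _ (16 * k) ⦃ >-nonZero (≤-trans 1≤k (m≤n*m k 16)) ⦄ ⟩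
    4 * (s * s * k) * (16 * k)  ≡⟨ expand s k ⟩
    64 * z                      ∎
    where
    expand : ∀ s k → 4 * (s * s * k) * (16 * k) ≡ 64 * (s * (s * k) * k)
    expand = solve-∀

m<8*[1+m]³*n : ∀ m n ⦃ _ : NonZero n ⦄ → m < 8 * (suc m * suc m * suc m) * n
m<8*[1+m]³*n m n = begin
  suc m                              ≤⟨ m≤m*n (suc m) (suc m) ⟩
  suc m * suc m                      ≤⟨ m≤m*n (suc m * suc m) (suc m) ⟩
  suc m * suc m * suc m              ≤⟨ m≤n*m _ 8 ⟩
  8 * (suc m * suc m * suc m)        ≤⟨ m≤m*n _ n ⟩
  8 * (suc m * suc m * suc m) * n    ∎
  where open ≤-Reasoning

record GridParameters (n p : ℕ) : Set where
  field
    s k t    : ℕ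
    k≢0      : NonZero k
    t≢0      : NonZero t
    grid≤n   : k * (pred s * pred k + t) ≤ n
    lines≤p  : s * t ≤ p
    ample    : Ample n p (s * t * k ⊔ p)

-- A single horizontal line through all n nodes.
hamiltonianPath : ∀ {n p} ⦃ _ : NonZero n ⦄ → 1 ≤ p →
                  n * n * p * p ≤ 8 * ((n ⊔ p) * (n ⊔ p) * (n ⊔ p)) → GridParameters n p
hamiltonianPath {n} {p} ⦃ n≢0 ⦄ 1≤p np≤ = record
  { s = 1 ; k = n ; t = 1
  ; k≢0 = n≢0
  ; t≢0 = _
  ; grid≤n = ≤-reflexive (*-identityʳ n)
  ; lines≤p = 1≤p
  ; ample = subst (λ z → Ample n p (z ⊔ p)) (sym (*-identityˡ n)) (ample-⊔ np≤)
  }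

balancedGrid : ∀ {n p k} → 1 ≤ k → k ≤ p →
               8 * (k * k * k) * p ≤ n * n → n * n < 8 * (suc k * suc k * suc k) * p → GridParameters n p
balancedGrid {n} {p} {k} 1≤k k≤p k-fits k+1-too-big
  with lastBeforeFailure (λ s → s * s * k ≤? p) p (subst (_≤ p) (sym (*-identityˡ k)) k≤p)
         (<⇒≱ (≤-trans (m≤m*n (suc p) (suc p)) (m≤m*n _ k ⦃ >-nonZero 1≤k ⦄)))
... | s , 1≤s , s-fits , s+1-too-big = record
  { s = s ; k = k ; t = s * k
  ; k≢0 = >-nonZero 1≤k
  ; t≢0 = >-nonZero (*-mono-≤ 1≤s 1≤k)
  ; grid≤n = grid-fits {s = s} {k} k-fits s-fits
  ; lines≤p = subst (_≤ p) (*-assoc s s k) s-fits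
  ; ample = Ample-mono (m≤m⊔n (s * (s * k) * k) p) (ample-grid 1≤s 1≤k n≤ p≤)
  }
  where
  p≤ = paths-below {k = k} 1≤s (≰⇒> s+1-too-big)
  n≤ = nodes-below {s = s} 1≤k k+1-too-big p≤

gridParameters : ∀ n p ⦃ _ : NonZero n ⦄ ⦃ _ : NonZero p ⦄ → GridParameters n p
gridParameters n p with 8 * p ≤? n * n
... | no 8p≰n² = hamiltonianPath (>-nonZero⁻¹ p) (few-nodes-bound {n} {p} (<⇒≤ (≰⇒> 8p≰n²)))
... | yes 8p≤n²
  with lastBeforeFailure (λ k → 8 * (k * k * k) * p ≤? n * n) (n * n) 8p≤n²
         (<⇒≱ (m<8*[1+m]³*n (n * n) p))
...   | k , 1≤k , k-fits , k+1-too-big with k ≤? p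
...     | no  k≰p = hamiltonianPath (>-nonZero⁻¹ p)
                    (few-paths-bound {n} {p} (8k³p≤n²⇒p*p≤n (<⇒≤ (≰⇒> k≰p)) k-fits))
...     | yes k≤p = balancedGrid 1≤k k≤p k-fits (≰⇒> k+1-too-big)

mainTheorem15 : ∃[ C ] (1 ≤ C × (∀ (n p : ℕ) → 1 ≤ n → 1 ≤ p →
                  Σ (OrderedPathSystem n p) λ S → NoOrderedBridge S
                    × n * n * p * p ≤ (C * size S) ^ 3
                    × n ≤ C * size S
                    × p ≤ C * size S))
mainTheorem15 = 64 , s≤s z≤n , construction
  where
  construction : ∀ n p → 1 ≤ n → 1 ≤ p → Σ (OrderedPathSystem n p) λ S → NoOrderedBridge S × Ample n p (size S)
  construction n p 1≤n 1≤p = system , noOrderedBridge drawing , Ample-mono (⊔-lub size-≥-lines size-≥-paths) ample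
    where
    open GridParameters (gridParameters n p ⦃ >-nonZero 1≤n ⦄ ⦃ >-nonZero 1≤p ⦄)
    open GridSystem n p s k t ⦃ k≢0 ⦄ ⦃ t≢0 ⦄ grid≤n lines≤p
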